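{- Fix an integer $h\ge 1$ and consider the tree $T$ and active set obtained (under the reference semantics) after any valid sequence of tree-buffer operations. Then every node of $T$ is either doomed or recent, and not both: $T=R\uplus D$.
   Context: A valid sequence of tree-buffer operations is $\mathrm{initialize}(x_0)$ followed by modifying operations $\mathrm{add\_child}(x,y)$ or $\mathrm{deactivate}(x)$, with the following semantics on a rooted tree $T$ and a set $\mathrm{Active}\subseteq T$: initialize creates the tree with single node $x_0$ (the root), Active $=\{x_0\}$; $\mathrm{add\_child}(x,y)$ requires $x\in$ Active and $y$ fresh, and adds $y$ to $T$ as a child of $x$ and to Active; $\mathrm{deactivate}(x)$ removes $x$ from Active (nodes are never removed from $T$). The subtree of $x$ is $x$ together with its descendants. The depth of a node is its distance to the root, and $\mathrm{level}(x)=\lfloor\mathrm{depth}(x)/h\rfloor$. The representative $\mathrm{rep}(x)$ of $x$ is the closest ancestor of $x$ (including $x$ itself) whose depth is a multiple of $h$. The active count $\mathrm{cnt}(x)$ is the number of active nodes $y$ with $\mathrm{rep}(y)=x$. A node $x$ is recent if there is an active node $y$ in the subtree of $x$ with $\mathrm{level}(x)\ge\mathrm{level}(y)-1$; $R$ is the set of recent nodes. A node $x$ is fringe if $\mathrm{depth}(x)\equiv 0\pmod h$ and $\mathrm{cnt}(x)=0$. The set $D$ of doomed nodes is defined recursively (by induction on the height of subtrees): $x$ is doomed if $x$ is inactive and each child of $x$ is fringe or doomed (in particular an inactive leaf is doomed). -}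

module Defs where

open import Data.Nat using (ℕ; zero; suc; _≤_; _/_; NonZero)
open import Data.Nat.Divisibility using (_∣_)
open import Data.Nat.Properties using (_≟_)
open import Data.List using (List; []; _∷_; filter)
open import Data.List.Membership.Propositional using (_∈_)
open import Data.Product using (_×_; _,_; ∃; ∃-syntax)
open import Data.Sum using (_⊎_)
open import Relation.Nullary using (¬_)
open import Relation.Nullary.Decidable using (¬?)
open import Relation.Binary.PropositionalEquality using (_≡_)

-- Nodes are labelled by natural numbers.
-- State of the reference semantics: the root, the parent edges
-- (child , parent), and the list of active nodes.
record State : Set where
  constructor mkState
  field
    root   : ℕ
    edges  : List (ℕ × ℕ)
    active : List ℕ
open State public

Parent : State → ℕ → ℕ → Set
Parent s c p = (c , p) ∈ edges s

Node : State → ℕ → Set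
Node s x = x ≡ root s ⊎ ∃[ p ] Parent s x p

Active : State → ℕ → Set
Active s x = x ∈ active s

data Op : Set where
  addChild   : ℕ → ℕ → Op
  deactivate : ℕ → Op

initialize : ℕ → State
initialize x₀ = mkState x₀ [] (x₀ ∷ [])

data Step : State → Op → State → Set where
  step-add : ∀ {s x y} → Active s x → ¬ Node s y →
    Step s (addChild x y) (mkState (root s) ((y , x) ∷ edges s) (y ∷ active s))
  step-deact : ∀ {s x} →
    Step s (deactivate x) (mkState (root s) (edges s) (filter (λ z → ¬? (z ≟ x)) (active s)))

data Reachable : State → Set where
  init : ∀ x₀ → Reachable (initialize x₀)
  next : ∀ {s o s'} → Reachable s → Step s o s' → Reachable s'

data AncOrSelf (s : State) : ℕ → ℕ → Set where
  here  : ∀ {x} → AncOrSelf s x x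
  there : ∀ {a x p} → Parent s x p → AncOrSelf s a p → AncOrSelf s a x

data Depth (s : State) : ℕ → ℕ → Set where
  depth-root : Depth s (root s) 0
  depth-step : ∀ {x p d} → Parent s x p → Depth s p d → Depth s x (suc d)

module _ (h : ℕ) .{{_ : NonZero h}} where

  level : ℕ → ℕ
  level d = d / h

  -- r = rep(x): closest ancestor of x (incl. x) whose depth is a multiple of h
  IsRep : State → ℕ → ℕ → Set
  IsRep s x r =
    AncOrSelf s r x ×
    (∃[ dr ] (Depth s r dr × h ∣ dr)) ×
    (∀ a da → AncOrSelf s a x → AncOrSelf s r a → Depth s a da → h ∣ da → a ≡ r)

  -- cnt(x) = 0 : no active node y has rep(y) = x
  CntZero : State → ℕ → Set
  CntZero s x = ¬ (∃[ y ] (Active s y × IsRep s y x))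

  Fringe : State → ℕ → Set
  Fringe s x = (∃[ d ] (Depth s x d × h ∣ d)) × CntZero s x

  -- level(x) ≥ level(y) - 1  ⇔  level(y) ≤ level(x) + 1
  Recent : State → ℕ → Set
  Recent s x = ∃[ y ] (Active s y × AncOrSelf s x y ×
    ∃[ dx ] ∃[ dy ] (Depth s x dx × Depth s y dy × level dy ≤ suc (level dx)))

  data Doomed (s : State) : ℕ → Set where
    doomed : ∀ {x} → ¬ Active s x →
      (∀ c → Parent s c x → Fringe s c ⊎ Doomed s c) → Doomed s x

-- A node c whose depth is a multiple of h represents exactly the nodes of its subtree
-- lying on its own level.  Disjointness is then an induction on doomedness: an active
-- witness of recency below a doomed x sits under a doomed child (recurse) or under a
-- fringe child c, whose level is level x + 1, so c represents the witness, contradicting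
-- cnt c = 0.  Covering is a well-founded induction down the tree: a non-recent x is
-- inactive, and a recent child c of x must start level x + 1; any active node that c
-- represents lies on that level and would make x recent, so c is fringe.  Recency is
-- decidable because the active set is a finite list.
module Submission where

open import Data.Nat
  using (ℕ; suc; _+_; _*_; _/_; _%_; _≤_; _<_; s≤s; NonZero; >-nonZero⁻¹)
open import Data.Nat.Properties
  using ( _≟_; _≤?_; ≤-refl; ≤-trans; ≤-antisym; ≤-pred; ≤-reflexive; n≤1+n; n<1+n
        ; m≤n⇒m≤1+n; <⇒≢; <⇒≱; ≰⇒>; ≤∧≢⇒<; m≤m+n; m<m+n; +-comm; +-monoˡ-<
        ; *-monoˡ-≤; *-cancelʳ-<; module ≤-Reasoning)
open import Data.Nat.DivMod
  using (m≡m%n+[m/n]*n; m%n<n; m*n/n≡m; m/n*n≤m; m/n*n≡m; /-monoˡ-≤; /-cancelʳ-≡)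
open import Data.Nat.Divisibility using (_∣_; divides; ∣m∣n⇒∣m+n; ∣-refl)
open import Data.List using (List; []; _∷_)
open import Data.List.Relation.Unary.Any using (here; there)
open import Data.List.Membership.Propositional using (_∈_)
open import Data.List.Membership.Propositional.Properties using (∈-filter⁻)
open import Data.Product using (∃; ∃-syntax; _×_; _,_; proj₁)
open import Data.Product.Properties using (,-injectiveˡ; ,-injectiveʳ)
open import Data.Sum using (_⊎_; inj₁; inj₂)
open import Data.Empty using (⊥-elim)
open import Relation.Nullary using (¬_; Dec; yes; no)
open import Relation.Nullary.Decidable using (¬?; map′; _×-dec_; _⊎-dec_)
open import Relation.Binary.PropositionalEquality using (_≡_; refl; sym; cong; subst)
open import Induction.WellFounded using (Acc; acc)

open import Defs

m<[1+m/n]*n : ∀ m n .{{_ : NonZero n}} → m < suc (m / n) * n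
m<[1+m/n]*n m n = begin-strict
  m                 ≡⟨ m≡m%n+[m/n]*n m n ⟩
  m % n + m / n * n <⟨ +-monoˡ-< (m / n * n) (m%n<n m n) ⟩
  n + m / n * n     ∎
  where open ≤-Reasoning

[1+m]/n≤1+m/n : ∀ m n .{{_ : NonZero n}} → suc m / n ≤ suc (m / n)
[1+m]/n≤1+m/n m n = begin
  suc m / n           ≤⟨ /-monoˡ-≤ n (m<[1+m/n]*n m n) ⟩
  suc (m / n) * n / n ≡⟨ m*n/n≡m (suc (m / n)) n ⟩
  suc (m / n)         ∎
  where open ≤-Reasoning

n∣1+m⇒[1+m]/n≡1+m/n : ∀ m n .{{_ : NonZero n}} → n ∣ suc m → suc m / n ≡ suc (m / n)
n∣1+m⇒[1+m]/n≡1+m/n m n n∣1+m =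
  ≤-antisym ([1+m]/n≤1+m/n m n) (*-cancelʳ-< n (m / n) (suc m / n) (begin-strict
    m / n * n     ≤⟨ m/n*n≤m m n ⟩
    m             <⟨ n<1+n m ⟩
    suc m         ≡⟨ m/n*n≡m n∣1+m ⟨
    suc m / n * n ∎))
  where open ≤-Reasoning

[1+m]/n≡1+m/n⇒n∣1+m : ∀ m n .{{_ : NonZero n}} → suc m / n ≡ suc (m / n) → n ∣ suc m
[1+m]/n≡1+m/n⇒n∣1+m m n eq = divides (suc (m / n)) (≤-antisym (m<[1+m/n]*n m n) (begin
  suc (m / n) * n ≡⟨ cong (_* n) eq ⟨
  suc m / n * n   ≤⟨ m/n*n≤m (suc m) n ⟩
  suc m           ∎))
  where open ≤-Reasoning

n∣m∧1+m/n≤o/n⇒m+n≤o : ∀ m n o .{{_ : NonZero n}} → n ∣ m → suc (m / n) ≤ o / n → m + n ≤ o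
n∣m∧1+m/n≤o/n⇒m+n≤o m n o n∣m le = begin
  m + n           ≡⟨ +-comm m n ⟩
  n + m           ≡⟨ cong (n +_) (m/n*n≡m n∣m) ⟨
  suc (m / n) * n ≤⟨ *-monoˡ-≤ n le ⟩
  o / n * n       ≤⟨ m/n*n≤m o n ⟩
  o               ∎
  where open ≤-Reasoning

record WellFormed (s : State) : Set where
  field
    parent-node   : ∀ {c p} → Parent s c p → Node s p
    active-node   : ∀ {x} → Active s x → Node s x
    parent-unique : ∀ {c p q} → Parent s c p → Parent s c q → p ≡ q
    root-orphan   : ∀ {p} → ¬ Parent s (root s) p
    node-depth    : ∀ {x} → Node s x → ∃ (Depth s x)
    children-wf   : ∀ x → Acc (Parent s) x

Depth-mono-edges : ∀ {s e a z d} → (∀ {c p} → Parent s c p → (c , p) ∈ e) →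
  Depth s z d → Depth (mkState (root s) e a) z d
Depth-mono-edges f depth-root       = depth-root
Depth-mono-edges f (depth-step p D) = depth-step (f p) (Depth-mono-edges f D)

initialize-wellFormed : ∀ x₀ → WellFormed (initialize x₀)
initialize-wellFormed x₀ = record
  { parent-node   = λ ()
  ; active-node   = λ { (here refl) → inj₁ refl }
  ; parent-unique = λ ()
  ; root-orphan   = λ ()
  ; node-depth    = λ { (inj₁ refl) → 0 , depth-root ; (inj₂ (_ , ())) }
  ; children-wf   = λ _ → acc λ ()
  }

Step-wellFormed : ∀ {s o s′} → WellFormed s → Step s o s′ → WellFormed s′
Step-wellFormed {s} wf (step-add {x = x} {y = y} ax y∉T) = record
  { parent-node   = parent-node′
  ; active-node   = active-node′
  ; parent-unique = parent-unique′
  ; root-orphan   = root-orphan′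
  ; node-depth    = node-depth′
  ; children-wf   = λ z → acc-lift (children-wf z)
  }
  where
  open WellFormed wf
  s′ = mkState (root s) ((y , x) ∷ edges s) (y ∷ active s)

  node-lift : ∀ {z} → Node s z → Node s′ z
  node-lift (inj₁ z≡root)   = inj₁ z≡root
  node-lift (inj₂ (p , z→p)) = inj₂ (p , there z→p)

  parent-node′ : ∀ {c p} → Parent s′ c p → Node s′ p
  parent-node′ (here refl) = node-lift (active-node ax)
  parent-node′ (there c→p) = node-lift (parent-node c→p)

  active-node′ : ∀ {z} → Active s′ z → Node s′ z
  active-node′ (here refl) = inj₂ (x , here refl)
  active-node′ (there az)  = node-lift (active-node az)

  parent-unique′ : ∀ {c p q} → Parent s′ c p → Parent s′ c q → p ≡ q
  parent-unique′ (here refl) (here refl) = refl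
  parent-unique′ (here refl) (there y→q) = ⊥-elim (y∉T (inj₂ (_ , y→q)))
  parent-unique′ (there y→p) (here refl) = ⊥-elim (y∉T (inj₂ (_ , y→p)))
  parent-unique′ (there c→p) (there c→q) = parent-unique c→p c→q

  root-orphan′ : ∀ {p} → ¬ Parent s′ (root s) p
  root-orphan′ (here eq)    = y∉T (inj₁ (sym (,-injectiveˡ eq)))
  root-orphan′ (there r→p) = root-orphan r→p

  node-depth′ : ∀ {z} → Node s′ z → ∃ (Depth s′ z)
  node-depth′ (inj₁ refl) = 0 , depth-root
  node-depth′ (inj₂ (_ , here refl)) with node-depth (active-node ax)
  ... | d , D = suc d , depth-step (here refl) (Depth-mono-edges there D)
  node-depth′ (inj₂ (p , there z→p)) with node-depth (inj₂ (p , z→p))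
  ... | d , D = d , Depth-mono-edges there D

  y-childless : Acc (Parent s′) y
  y-childless = acc λ
    { (here eq)   → ⊥-elim (y∉T (subst (Node s) (sym (,-injectiveʳ eq)) (active-node ax)))
    ; (there c→y) → ⊥-elim (y∉T (parent-node c→y)) }

  acc-lift : ∀ {z} → Acc (Parent s) z → Acc (Parent s′) z
  acc-lift (acc rs) = acc λ { (here refl) → y-childless ; (there c→z) → acc-lift (rs c→z) }
Step-wellFormed wf (step-deact {x = x}) = record
  { parent-node   = parent-node
  ; active-node   = λ az → active-node (proj₁ (∈-filter⁻ (λ z → ¬? (z ≟ x)) az))
  ; parent-unique = parent-unique
  ; root-orphan   = root-orphan
  ; node-depth    = λ nz → let (d , D) = node-depth nz in d , Depth-mono-edges (λ e → e) D
  ; children-wf   = children-wf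
  }
  where open WellFormed wf

Reachable⇒WellFormed : ∀ {s} → Reachable s → WellFormed s
Reachable⇒WellFormed (init x₀)    = initialize-wellFormed x₀
Reachable⇒WellFormed (next r st) = Step-wellFormed (Reachable⇒WellFormed r) st

module _ {s : State} (wf : WellFormed s) where
  open WellFormed wf

  Depth-functional : ∀ {x d d′} → Depth s x d → Depth s x d′ → d ≡ d′
  Depth-functional depth-root        depth-root          = refl
  Depth-functional depth-root        (depth-step r→p _) = ⊥-elim (root-orphan r→p)
  Depth-functional (depth-step r→p _) depth-root        = ⊥-elim (root-orphan r→p)
  Depth-functional (depth-step x→p D) (depth-step x→q D′) with parent-unique x→p x→q
  ... | refl = cong suc (Depth-functional D D′)

  Depth-parent : ∀ {x p d} → Parent s x p → Depth s x d → ∃[ d′ ] (Depth s p d′ × d ≡ suc d′)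
  Depth-parent x→p depth-root         = ⊥-elim (root-orphan x→p)
  Depth-parent x→p (depth-step x→q D) with parent-unique x→p x→q
  ... | refl = _ , D , refl

  AncOrSelf-trans : ∀ {a b c} → AncOrSelf s a b → AncOrSelf s b c → AncOrSelf s a c
  AncOrSelf-trans a≤b here          = a≤b
  AncOrSelf-trans a≤b (there c→p b≤p) = there c→p (AncOrSelf-trans a≤b b≤p)

  AncOrSelf-split : ∀ {a x} → AncOrSelf s a x →
    a ≡ x ⊎ ∃[ c ] (Parent s c a × AncOrSelf s c x)
  AncOrSelf-split here = inj₁ refl
  AncOrSelf-split (there {x = x} x→p a≤p) with AncOrSelf-split a≤p
  ... | inj₁ refl              = inj₂ (x , x→p , here)
  ... | inj₂ (c , c→a , c≤p) = inj₂ (c , c→a , there x→p c≤p)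

  AncOrSelf-depth : ∀ {a z dz} → AncOrSelf s a z → Depth s z dz →
    ∃[ da ] (Depth s a da × da ≤ dz × (da ≡ dz → a ≡ z))
  AncOrSelf-depth here D = _ , D , ≤-refl , λ _ → refl
  AncOrSelf-depth (there z→p a≤p) D with Depth-parent z→p D
  ... | _ , Dp , refl with AncOrSelf-depth a≤p Dp
  ... | da , Da , da≤ , _ = da , Da , m≤n⇒m≤1+n da≤ , λ eq → ⊥-elim (<⇒≢ (s≤s da≤) eq)

  AncOrSelf-at-depth : ∀ {c z dc dz k} → AncOrSelf s c z → Depth s c dc → Depth s z dz →
    dc ≤ k → k ≤ dz → ∃[ a ] (Depth s a k × AncOrSelf s c a × AncOrSelf s a z)
  AncOrSelf-at-depth here Dc Dz dc≤k k≤dz with Depth-functional Dc Dz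
  ... | refl with ≤-antisym dc≤k k≤dz
  ... | refl = _ , Dc , here , here
  AncOrSelf-at-depth {z = z} {k = k} (there z→p c≤p) Dc Dz dc≤k k≤dz with Depth-parent z→p Dz
  ... | dp , Dp , refl with k ≟ suc dp
  ... | yes refl = z , Dz , there z→p c≤p , here
  ... | no k≢ with AncOrSelf-at-depth c≤p Dc Dp dc≤k (≤-pred (≤∧≢⇒< k≤dz k≢))
  ... | a , Da , c≤a , a≤p = a , Da , c≤a , there z→p a≤p

  AncOrSelf? : ∀ a {z dz} → Depth s z dz → Dec (AncOrSelf s a z)
  AncOrSelf? a depth-root with a ≟ root s
  ... | yes refl = yes here
  ... | no a≢r   = no λ { here → a≢r refl ; (there r→p _) → root-orphan r→p }
  AncOrSelf? a {z} (depth-step z→p D) with a ≟ z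
  ... | yes refl = yes here
  ... | no a≢z with AncOrSelf? a D
  ... | yes a≤p = yes (there z→p a≤p)
  ... | no a≰p  = no λ { here → a≢z refl
                       ; (there z→q a≤q) → a≰p (subst (AncOrSelf s a) (parent-unique z→q z→p) a≤q) }

∃∈? : {A : Set} {P : A → Set} (xs : List A) →
  (∀ {y} → y ∈ xs → Dec (P y)) → Dec (∃[ y ] (y ∈ xs × P y))
∃∈? []       P? = no λ { (_ , () , _) }
∃∈? {P = P} (x ∷ xs) P? = map′ cons uncons (P? (here refl) ⊎-dec ∃∈? xs (λ y∈ → P? (there y∈)))
  where
  cons : P x ⊎ ∃[ y ] (y ∈ xs × P y) → ∃[ y ] (y ∈ x ∷ xs × P y)
  cons (inj₁ px)             = x , here refl , px
  cons (inj₂ (y , y∈ , py)) = y , there y∈ , py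
  uncons : ∃[ y ] (y ∈ x ∷ xs × P y) → P x ⊎ ∃[ y ] (y ∈ xs × P y)
  uncons (_ , here refl , px) = inj₁ px
  uncons (y , there y∈ , py)  = inj₂ (y , y∈ , py)

module _ (h : ℕ) .{{_ : NonZero h}} {s : State} (wf : WellFormed s) where
  open WellFormed wf

  rep-of-level : ∀ {c y dc dy} → AncOrSelf s c y → Depth s c dc → h ∣ dc → Depth s y dy →
    level h dy ≤ level h dc → IsRep h s y c
  rep-of-level {c} {y} {dc} c≤y Dc h∣dc Dy ly≤lc = c≤y , (dc , Dc , h∣dc) , closest
    where
    closest : ∀ a da → AncOrSelf s a y → AncOrSelf s c a → Depth s a da → h ∣ da → a ≡ c
    closest a da a≤y c≤a Da h∣da with AncOrSelf-depth wf c≤a Da | AncOrSelf-depth wf a≤y Dy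
    ... | _ , Dc′ , dc≤da , dc≡da⇒c≡a | _ , Da′ , da≤dy , _
      with Depth-functional wf Dc′ Dc | Depth-functional wf Da′ Da
    ... | refl | refl = sym (dc≡da⇒c≡a (/-cancelʳ-≡ h∣dc h∣da
          (≤-antisym (/-monoˡ-≤ h dc≤da) (≤-trans (/-monoˡ-≤ h da≤dy) ly≤lc))))

  -- Otherwise the ancestor of z at depth dc + h would be an ancestor of z below c with
  -- depth divisible by h, contradicting that c is the closest one.
  rep-level≤ : ∀ {z c dz dc} → IsRep h s z c → Depth s z dz → Depth s c dc →
    level h dz ≤ level h dc
  rep-level≤ {dz = dz} {dc} (c≤z , (_ , Dc′ , h∣dc) , closest) Dz Dc
    with Depth-functional wf Dc′ Dc
  ... | refl with level h dz ≤? level h dc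
  ... | yes lz≤lc = lz≤lc
  ... | no lz≰lc
    with AncOrSelf-at-depth wf c≤z Dc Dz (m≤m+n dc h)
           (n∣m∧1+m/n≤o/n⇒m+n≤o dc h dz h∣dc (≰⇒> lz≰lc))
  ... | a , Da , c≤a , a≤z with closest a (dc + h) a≤z c≤a Da (∣m∣n⇒∣m+n h∣dc ∣-refl)
  ... | refl = ⊥-elim (<⇒≢ (m<m+n dc (>-nonZero⁻¹ h)) (Depth-functional wf Dc Da))

  doomed⇒¬recent : ∀ {x} → Doomed h s x → ¬ Recent h s x
  doomed⇒¬recent (doomed ¬ax child) (y , ay , x≤y , dx , dy , Dx , Dy , ly≤)
    with AncOrSelf-split wf x≤y
  ... | inj₁ refl = ¬ax ay
  ... | inj₂ (c , c→x , c≤y) with child c c→x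
  ... | inj₂ doomed-c = doomed⇒¬recent doomed-c
          (y , ay , c≤y , suc dx , dy , depth-step c→x Dx , Dy ,
           ≤-trans ly≤ (s≤s (/-monoˡ-≤ h (n≤1+n dx))))
  ... | inj₁ ((dc , Dc , h∣dc) , cnt≡0) with Depth-functional wf Dc (depth-step c→x Dx)
  ... | refl = cnt≡0 (y , ay , rep-of-level c≤y Dc h∣dc Dy
          (≤-trans ly≤ (≤-reflexive (sym (n∣1+m⇒[1+m]/n≡1+m/n dx h h∣dc)))))

  recent? : ∀ {x dx} → Depth s x dx → Dec (Recent h s x)
  recent? {x} {dx} Dx = map′ from to (∃∈? (active s) witness?)
    where
    Witness : ℕ → Set
    Witness y = AncOrSelf s x y × ∃[ dy ] (Depth s y dy × level h dy ≤ suc (level h dx))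
    witness? : ∀ {y} → Active s y → Dec (Witness y)
    witness? ay with node-depth (active-node ay)
    ... | dy , Dy = map′ (λ (x≤y , le) → x≤y , dy , Dy , le) forget
                         (AncOrSelf? wf x Dy ×-dec level h dy ≤? suc (level h dx))
      where
      forget : Witness _ → AncOrSelf s x _ × level h dy ≤ suc (level h dx)
      forget (x≤y , _ , Dy′ , le) =
        x≤y , subst (λ d → level h d ≤ suc (level h dx)) (Depth-functional wf Dy′ Dy) le
    from : ∃[ y ] (Active s y × Witness y) → Recent h s x
    from (y , ay , x≤y , dy , Dy , le) = y , ay , x≤y , dx , dy , Dx , Dy , le
    to : Recent h s x → ∃[ y ] (Active s y × Witness y)
    to (y , ay , x≤y , _ , dy , Dx′ , Dy , le) with Depth-functional wf Dx′ Dx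
    ... | refl = y , ay , x≤y , dy , Dy , le

  recent-child⇒fringe : ∀ {c x dx} → Parent s c x → Depth s x dx →
    ¬ Recent h s x → Recent h s c → Fringe h s c
  recent-child⇒fringe {c} {x} {dx} c→x Dx ¬rx (y , ay , c≤y , _ , dy , Dc , Dy , ly≤)
    with Depth-functional wf Dc (depth-step c→x Dx)
  ... | refl = (suc dx , Dc , h∣dc) , cnt≡0
    where
    deep : ∀ {z dz} → Active s z → AncOrSelf s c z → Depth s z dz →
      suc (suc (level h dx)) ≤ level h dz
    deep {z} {dz} az c≤z Dz = ≰⇒> λ lz≤ →
      ¬rx (z , az , AncOrSelf-trans wf (there c→x here) c≤z , dx , dz , Dx , Dz , lz≤)
    lc≡ : level h (suc dx) ≡ suc (level h dx)
    lc≡ = ≤-antisym ([1+m]/n≤1+m/n dx h) (≤-pred (≤-trans (deep ay c≤y Dy) ly≤))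
    h∣dc : h ∣ suc dx
    h∣dc = [1+m]/n≡1+m/n⇒n∣1+m dx h lc≡
    cnt≡0 : CntZero h s c
    cnt≡0 (z , az , rep) with node-depth (active-node az)
    ... | dz , Dz = <⇒≱ (deep az (proj₁ rep) Dz)
          (≤-trans (rep-level≤ rep Dz Dc) (≤-reflexive lc≡))

  ¬recent⇒doomed : ∀ {x dx} → Acc (Parent s) x → Depth s x dx → ¬ Recent h s x → Doomed h s x
  ¬recent⇒doomed {x} {dx} (acc below) Dx ¬rx = doomed ¬ax child
    where
    ¬ax : ¬ Active s x
    ¬ax ax = ¬rx (x , ax , here , dx , dx , Dx , Dx , n≤1+n _)
    child : ∀ c → Parent s c x → Fringe h s c ⊎ Doomed h s c
    child c c→x with recent? (depth-step c→x Dx)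
    ... | yes rc = inj₁ (recent-child⇒fringe c→x Dx ¬rx rc)
    ... | no ¬rc = inj₂ (¬recent⇒doomed (below c→x) (depth-step c→x Dx) ¬rc)

lemma5 : (h : ℕ) .{{_ : NonZero h}} (s : State) → Reachable s →
    ∀ x → Node s x →
    (Recent h s x × ¬ Doomed h s x) ⊎ (Doomed h s x × ¬ Recent h s x)
lemma5 h s r x x∈T with Reachable⇒WellFormed r
... | wf with WellFormed.node-depth wf x∈T
... | _ , Dx with recent? h wf Dx
... | yes rx = inj₁ (rx , λ dx → doomed⇒¬recent h wf dx rx)
... | no ¬rx = inj₂ (¬recent⇒doomed h wf (WellFormed.children-wf wf x) Dx ¬rx , ¬rx)
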